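{- Let $\alpha,\beta$ be state types, $\rho$ a code retrieving function for terms over $\alpha$, $\rho'$ one for terms over $\beta$, $r\subseteq\alpha\times\beta$, $p$ a term over $\alpha$ and $q$ a term over $\beta$. Let $R,G\subseteq\alpha\times\alpha$, $P,Q\subseteq\alpha$, $R',G'\subseteq\beta\times\beta$, $P',Q'\subseteq\beta$. Assume $\rho,\rho'\models p\sqsupseteq_r q$ and $\rho\models\{R,P\}\,p\,\{Q,G\}$, and (1) $r;R'\subseteq R;r$, (2) $P'\subseteq r(P)$, (3) $r(Q)\subseteq Q'$, (4) $r^{ -1};G;r\subseteq G'$. Then $\rho'\models\{R',P'\}\,q\,\{Q',G'\}$.
   Context: For a state type $\alpha$: a state predicate is a subset of $\alpha$, a state relation a subset of $\alpha\times\alpha$. For relations: $R(X)=\{b\mid\exists a\in X.\,(a,b)\in R\}$; $r;s=\{(a,b)\mid\exists c.\,(a,c)\in r\wedge(c,b)\in s\}$; $r^{ -1}$ is the converse. Program terms over $\alpha$ are generated by $p::=\mathbf{skip}\mid\mathbf{basic}\,f\mid\mathbf{cjump}\,C\,i\,p\mid\mathbf{while}\,C\,p\,p\mid\mathbf{if}\,C\,p\,p\mid p;p\mid\Vert(p_1,\dots,p_m)\mid\mathbf{await}\,C\,p$ with $f:\alpha\to\alpha$, $C\subseteq\alpha$, $i\in\mathbb N$, $m\ge1$ ($p_1;p_2;p_3$ means $p_1;(p_2;p_3)$). A code retrieving function is a map $\rho$ from $\mathbb N$ to terms. The program step relation $\rho\vdash(p,\sigma)\to_{\mathcal P}(p',\sigma')$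 is the least relation with: $(\mathbf{basic}\,f,\sigma)\to(\mathbf{skip},f\sigma)$; $(\mathbf{cjump}\,C\,i\,p,\sigma)\to(\rho\,i,\sigma)$ if $\sigma\in C$, $\to(p,\sigma)$ if $\sigma\notin C$; $(\mathbf{await}\,C\,p,\sigma)\to(\mathbf{skip},\sigma')$ if $\sigma\in C$ and $(p,\sigma)\to^*(\mathbf{skip},\sigma')$; $(\mathbf{if}\,C\,p_1\,p_2,\sigma)\to(p_1,\sigma)$ if $\sigma\in C$, $\to(p_2,\sigma)$ otherwise; for $x=\mathbf{while}\,C\,p_1\,p_2$: $(x,\sigma)\to(p_1;\mathbf{skip};x,\sigma)$ if $\sigma\in C$, $\to(p_2,\sigma)$ otherwise; $(p_1;p_2,\sigma)\to(p_1';p_2,\sigma')$ if $(p_1,\sigma)\to(p_1',\sigma')$; $(\mathbf{skip};p,\sigma)\to(p,\sigma)$; $(\Vert(\dots,p_i,\dots),\sigma)\to(\Vert(\dots,p_i',\dots),\sigma')$ if $(p_i,\sigma)\to(p_i',\sigma')$; $(\Vert(\mathbf{skip},\dots,\mathbf{skip}),\sigma)\to(\mathbf{skip},\sigma)$. A finite potential computation of $(\rho,p)$ is a nonempty finite sequence $(p_0,\sigma_0),\dots,(p_{n-1},\sigma_{n-1})$ with $p_0=p$ where each transition $i\to i+1$ is either a program step ($\rho\vdash(p_i,\sigma_i)\to_{\mathcal P}(p_{i+1},\sigma_{i+1})$) or an environment step ($p_{i+1}=p_i$, state arbitrary). Such a computation satisfies: the environment condition for $R$ if every environment step has $(\sigma_i,\sigma_{i+1})\in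 R$; the program condition for $G$ if every program step has $(\sigma_i,\sigma_{i+1})\in G$; the input condition for $P$ if $\sigma_0\in P$; the output condition for $Q$ if, whenever some $p_i=\mathbf{skip}$, the least such $i$ has $\sigma_i\in Q$. $\rho\models\{R,P\}\,p\,\{Q,G\}$ means every finite potential computation of $(\rho,p)$ satisfying the environment condition for $R$ and input condition for $P$ satisfies the output condition for $Q$ and the program condition for $G$. Simulation: a relation $X$ between terms over $\alpha$ and terms over $\beta$ is a simulation w.r.t. $\rho,\rho',r$ if (i) whenever $(p,q)\in X$, $(\sigma_1,\sigma_2)\in r$ and $\rho'\vdash(q,\sigma_2)\to_{\mathcal P}(q',\sigma_2')$, there are $p',\sigma_1'$ with $\rho\vdash(p,\sigma_1)\to_{\mathcal P}(p',\sigma_1')$, $(p',q')\in X$, $(\sigma_1',\sigma_2')\in r$; (ii) $(\mathbf{skip},q)\in X$ implies $q=\mathbf{skip}$; (iii) $(p,\mathbf{skip})\in X$ implies $p=\mathbf{skip}$. $\rho,\rho'\models p\sqsupseteq_r q$ means some simulation w.r.t. $\rho,\rho',r$ contains $(p,q)$. -}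

module Defs where

open import Level using (Level; _⊔_) renaming (suc to lsuc)
open import Data.Nat using (ℕ; zero; suc)
open import Data.Fin using (Fin; zero; suc; inject₁; _<_; toℕ)
open import Data.Vec using (Vec; _[_]≔_; lookup; replicate)
open import Data.Product using (Σ; ∃; _×_; _,_; proj₁; proj₂)
open import Data.Sum using (_⊎_)
open import Relation.Binary.PropositionalEquality using (_≡_)
open import Relation.Nullary using (¬_)

Pred : Set → Set₁
Pred α = α → Set

Rel : Set → Set → Set₁
Rel α β = α → β → Set

_⊆_ : {α : Set} → Pred α → Pred α → Set
P ⊆ Q = ∀ σ → P σ → Q σ

_⊆ᵣ_ : {α β : Set} → Rel α β → Rel α β → Set
r ⊆ᵣ s = ∀ a b → r a b → s a b

image : {α β : Set} → Rel α β → Pred α → Pred β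
image R X b = Σ _ λ a → X a × R a b

_⨾_ : {α β γ : Set} → Rel α β → Rel β γ → Rel α γ
(r ⨾ s) a b = Σ _ λ c → r a c × s c b

_⁻¹ : {α β : Set} → Rel α β → Rel β α
(r ⁻¹) b a = r a b

-- Program terms (parallel composition of m ≥ 1 components: Vec of length suc m)
data Term (α : Set) : Set₁ where
  skip  : Term α
  basic : (α → α) → Term α
  cjump : Pred α → ℕ → Term α → Term α
  while : Pred α → Term α → Term α → Term α
  if    : Pred α → Term α → Term α → Term α
  _∶_   : Term α → Term α → Term α
  par   : {m : ℕ} → Vec (Term α) (suc m) → Term α
  await : Pred α → Term α → Term α

infixr 5 _∶_

CodeRet : Set → Set₁
CodeRet α = ℕ → Term α

module _ {α : Set} (ρ : CodeRet α) where

  mutual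
    data Step : Term α × α → Term α × α → Set₁ where
      basicS  : ∀ f σ → Step (basic f , σ) (skip , f σ)
      cjumpT  : ∀ C i p σ → C σ → Step (cjump C i p , σ) (ρ i , σ)
      cjumpF  : ∀ C i p σ → ¬ C σ → Step (cjump C i p , σ) (p , σ)
      awaitS  : ∀ C p σ σ' → C σ → Steps (p , σ) (skip , σ') → Step (await C p , σ) (skip , σ')
      ifT     : ∀ C p₁ p₂ σ → C σ → Step (if C p₁ p₂ , σ) (p₁ , σ)
      ifF     : ∀ C p₁ p₂ σ → ¬ C σ → Step (if C p₁ p₂ , σ) (p₂ , σ)
      whileT  : ∀ C p₁ p₂ σ → C σ →
                Step (while C p₁ p₂ , σ) ((p₁ ∶ skip ∶ while C p₁ p₂) , σ)
      whileF  : ∀ C p₁ p₂ σ → ¬ C σ → Step (while C p₁ p₂ , σ) (p₂ , σ)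
      seqS    : ∀ p₁ p₁' p₂ σ σ' → Step (p₁ , σ) (p₁' , σ') → Step ((p₁ ∶ p₂) , σ) ((p₁' ∶ p₂) , σ')
      seqSkip : ∀ p σ → Step ((skip ∶ p) , σ) (p , σ)
      parS    : ∀ {m} (ps : Vec (Term α) (suc m)) (i : Fin (suc m)) p' σ σ' →
                Step (lookup ps i , σ) (p' , σ') → Step (par ps , σ) (par (ps [ i ]≔ p') , σ')
      parSkip : ∀ {m} σ → Step (par (replicate (suc m) skip) , σ) (skip , σ)

    data Steps : Term α × α → Term α × α → Set₁ where
      done : ∀ c → Steps c c
      more : ∀ c₁ c₂ c₃ → Step c₁ c₂ → Steps c₂ c₃ → Steps c₁ c₃

  -- A finite potential computation of (ρ , p): configurations c 0 … c n
  -- (length n+1 ≥ 1) with c 0 having term p, and each transition i → i+1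
  -- labelled as a program step or an environment step.
  data Label : Set where
    progL envL : Label

  record Computation (p : Term α) : Set₁ where
    field
      len   : ℕ
      conf  : Fin (suc len) → Term α × α
      start : proj₁ (conf zero) ≡ p
      label : Fin len → Label
      valid : ∀ (i : Fin len) →
        (label i ≡ progL → Step (conf (inject₁ i)) (conf (suc i))) ×
        (label i ≡ envL  → proj₁ (conf (suc i)) ≡ proj₁ (conf (inject₁ i)))

  module _ {p : Term α} (c : Computation p) where
    open Computation c
    term : Fin (suc len) → Term α
    term i = proj₁ (conf i)
    state : Fin (suc len) → α
    state i = proj₂ (conf i)

    EnvCond : Rel α α → Set
    EnvCond R = ∀ i → label i ≡ envL → R (state (inject₁ i)) (state (suc i))

    ProgCond : Rel α α → Set
    ProgCond G = ∀ i → label i ≡ progL → G (state (inject₁ i)) (state (suc i))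

    InCond : Pred α → Set
    InCond P = P (state zero)

    OutCond : Pred α → Set₁
    OutCond Q = ∀ i → term i ≡ skip → (∀ j → j < i → ¬ (term j ≡ skip)) → Q (state i)

  Valid : Rel α α → Pred α → Term α → Pred α → Rel α α → Set₁
  Valid R P p Q G = ∀ (c : Computation p) → EnvCond c R → InCond c P →
    OutCond c Q × ProgCond c G

IsSimulation : {α β : Set} → CodeRet α → CodeRet β → Rel α β →
               (Term α → Term β → Set₁) → Set₁
IsSimulation {α} {β} ρ ρ' r X =
  (∀ p q σ₁ σ₂ q' σ₂' → X p q → r σ₁ σ₂ → Step ρ' (q , σ₂) (q' , σ₂') →
     Σ (Term α) λ p' → Σ α λ σ₁' →
       Step ρ (p , σ₁) (p' , σ₁') × X p' q' × r σ₁' σ₂') ×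
  (∀ q → X skip q → q ≡ skip) ×
  (∀ p → X p skip → p ≡ skip)

Refines : {α β : Set} → CodeRet α → CodeRet β → Rel α β → Term α → Term β → Set₂
Refines {α} {β} ρ ρ' r p q =
  Σ (Term α → Term β → Set₁) λ X → IsSimulation ρ ρ' r X × X p q

module Submission where

-- Idea: every finite potential computation c' of the concrete program q can be
-- lifted, step by step, to a computation c of the abstract program p of the
-- same length and with the same labels, such that at every position the
-- abstract term is X-related to the concrete one (X the simulation) and the
-- abstract state is r-related to the concrete one.  A concrete program step is
-- answered by the simulation; a concrete environment step in R' is answered,
-- thanks to r ; R' ⊆ R ; r, by an abstract environment step in R.  Validity of
-- p then applies to c, and its conclusions transfer back to c': a first skip
-- of c' sits at a first skip of c (simulation clauses (ii) and (iii)), so its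
-- state lies in r(Q); and each program step of c' is flanked by r-related
-- states around a G-step of c, so it lies in r⁻¹ ; G ; r.

open import Defs
open import Data.Nat using (ℕ; zero; suc)
open import Data.Fin using (Fin; zero; suc; inject₁)
open import Data.Vec.Functional using (_∷_)
open import Data.Product using (Σ-syntax; _×_; _,_; proj₁; proj₂)
open import Function using (_∘_)
open import Relation.Binary.PropositionalEquality using (_≡_; refl; sym; subst)

Transition : {γ : Set} (ρ : CodeRet γ) → Label ρ → Term γ × γ → Term γ × γ → Set₁
Transition ρ l c c₁ = (l ≡ progL → Step ρ c c₁) × (l ≡ envL → proj₁ c₁ ≡ proj₁ c)

EnvRespects : {γ : Set} (ρ : CodeRet γ) → Rel γ γ → Label ρ → Term γ × γ → Term γ × γ → Set
EnvRespects ρ R l c c₁ = l ≡ envL → R (proj₂ c) (proj₂ c₁)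

module _ {α β : Set} {ρ : CodeRet α} {ρ' : CodeRet β} {r : Rel α β}
         {X : Term α → Term β → Set₁} (sim : IsSimulation ρ ρ' r X) where

  skipReflected : ∀ {p q} → X p q → q ≡ skip → p ≡ skip
  skipReflected {p} x refl = proj₂ (proj₂ sim) p x

  skipPreserved : ∀ {p q} → X p q → p ≡ skip → q ≡ skip
  skipPreserved {q = q} x refl = proj₁ (proj₂ sim) q x

module Lifting {α β : Set} {ρ : CodeRet α} {ρ' : CodeRet β} {r : Rel α β}
    {R : Rel α α} {R' : Rel β β} {X : Term α → Term β → Set₁}
    (sim : IsSimulation ρ ρ' r X) (envCommutes : (r ⨾ R') ⊆ᵣ (R ⨾ r)) where

  _≈_ : Term α × α → Term β × β → Set₁
  d ≈ c = X (proj₁ d) (proj₁ c) × r (proj₂ d) (proj₂ c)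

  liftLabel : Label ρ' → Label ρ
  liftLabel progL = progL
  liftLabel envL  = envL

  liftLabelProg : ∀ l → l ≡ progL → liftLabel l ≡ progL
  liftLabelProg progL refl = refl

  answerTransition : ∀ l {c c₁} d → d ≈ c →
    Transition ρ' l c c₁ → EnvRespects ρ' R' l c c₁ →
    Σ[ d₁ ∈ Term α × α ]
      d₁ ≈ c₁ × Transition ρ (liftLabel l) d d₁ × EnvRespects ρ R (liftLabel l) d d₁
  answerTransition progL (p , σ) (x , rστ) (step , _) _
    with proj₁ sim p _ σ _ _ _ x rστ (step refl)
  ... | p₁ , σ₁ , abstractStep , x₁ , rσ₁ =
    (p₁ , σ₁) , (x₁ , rσ₁) , ((λ _ → abstractStep) , (λ ())) , (λ ())
  answerTransition envL (p , σ) (x , rστ) (_ , sameTerm) envStep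
    with envCommutes σ _ (_ , rστ , envStep refl)
  ... | σ₁ , Rσσ₁ , rσ₁ =
    (p , σ₁) , (subst (X p) (sym (sameTerm refl)) x , rσ₁) ,
    ((λ ()) , (λ _ → refl)) , (λ _ → Rσσ₁)

  record Matches {n : ℕ} (conf' : Fin (suc n) → Term β × β) (lab : Fin n → Label ρ')
                 (conf : Fin (suc n) → Term α × α) : Set₁ where
    field
      corresponds : ∀ i → conf i ≈ conf' i
      transition  : ∀ i → Transition ρ (liftLabel (lab i)) (conf (inject₁ i)) (conf (suc i))
      respectsR   : ∀ i → EnvRespects ρ R (liftLabel (lab i)) (conf (inject₁ i)) (conf (suc i))

  liftRun : ∀ n (conf' : Fin (suc n) → Term β × β) (lab : Fin n → Label ρ') →
    (∀ i → Transition ρ' (lab i) (conf' (inject₁ i)) (conf' (suc i))) →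
    (∀ i → EnvRespects ρ' R' (lab i) (conf' (inject₁ i)) (conf' (suc i))) →
    ∀ d₀ → d₀ ≈ conf' zero →
    Σ[ rest ∈ (Fin n → Term α × α) ] Matches conf' lab (d₀ ∷ rest)
  liftRun zero conf' lab _ _ d₀ d₀≈ =
    (λ ()) , record { corresponds = λ { zero → d₀≈ } ; transition = λ () ; respectsR = λ () }
  liftRun (suc n) conf' lab trans envR d₀ d₀≈
    with answerTransition (lab zero) d₀ d₀≈ (trans zero) (envR zero)
  ... | d₁ , d₁≈ , trans₀ , envR₀
    with liftRun n (conf' ∘ suc) (lab ∘ suc) (trans ∘ suc) (envR ∘ suc) d₁ d₁≈
  ... | rest , M = (d₁ ∷ rest) , record
    { corresponds = λ { zero → d₀≈ ; (suc i) → Matches.corresponds M i }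
    ; transition  = λ { zero → trans₀ ; (suc i) → Matches.transition M i }
    ; respectsR   = λ { zero → envR₀ ; (suc i) → Matches.respectsR M i }
    }

  record Lift (p : Term α) (σ₀ : α) {q : Term β} (c' : Computation ρ' q) : Set₁ where
    field
      rest    : Fin (Computation.len c') → Term α × α
      matches : Matches (Computation.conf c') (Computation.label c') ((p , σ₀) ∷ rest)

    open Matches matches public

    computation : Computation ρ p
    computation = record
      { len   = Computation.len c'
      ; conf  = (p , σ₀) ∷ rest
      ; start = refl
      ; label = liftLabel ∘ Computation.label c'
      ; valid = transition
      }

  liftComputation : ∀ {p q σ₀} (c' : Computation ρ' q) → EnvCond ρ' c' R' →
    X p q → r σ₀ (state ρ' c' zero) → Lift p σ₀ c'
  liftComputation {p} {σ₀ = σ₀} c' envOK xpq rσ₀ =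
    record { rest = proj₁ lifted ; matches = proj₂ lifted }
    where
    open Computation c'
    lifted = liftRun len conf label valid envOK (p , σ₀) (subst (X p) (sym start) xpq , rσ₀)

  module _ {p q σ₀} {c' : Computation ρ' q} (L : Lift p σ₀ c') where
    open Lift L

    liftedEnvCond : EnvCond ρ computation R
    liftedEnvCond = respectsR

    outputTransfer : ∀ {Q} → OutCond ρ computation Q → OutCond ρ' c' (image r Q)
    outputTransfer out i termSkip minimal =
      state ρ computation i ,
      out i (skipReflected sim (proj₁ (corresponds i)) termSkip)
            (λ j j<i abstractSkip →
               minimal j j<i (skipPreserved sim (proj₁ (corresponds j)) abstractSkip)) ,
      proj₂ (corresponds i)

    guaranteeTransfer : ∀ {G} → ProgCond ρ computation G → ProgCond ρ' c' (((r ⁻¹) ⨾ G) ⨾ r)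
    guaranteeTransfer prog i isProg =
      state ρ computation (suc i) ,
      (state ρ computation (inject₁ i) , proj₂ (corresponds (inject₁ i)) ,
       prog i (liftLabelProg _ isProg)) ,
      proj₂ (corresponds (suc i))

mainTheorem1 : {α β : Set} (ρ : CodeRet α) (ρ' : CodeRet β) (r : Rel α β)
    (p : Term α) (q : Term β)
    (R G : Rel α α) (P Q : Pred α) (R' G' : Rel β β) (P' Q' : Pred β) →
    Refines ρ ρ' r p q →
    Valid ρ R P p Q G →
    (r ⨾ R') ⊆ᵣ (R ⨾ r) →
    P' ⊆ image r P →
    image r Q ⊆ Q' →
    (((r ⁻¹) ⨾ G) ⨾ r) ⊆ᵣ G' →
    Valid ρ' R' P' q Q' G'
mainTheorem1 {α} ρ ρ' r p q R G P Q R' G' P' Q' (X , sim , xpq) pValid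
             envCommutes pre post guar c' envOK preOK =
  (λ i termSkip minimal → post _ (outputTransfer L (proj₁ abstractValid) i termSkip minimal)) ,
  (λ i isProg → guar _ _ (guaranteeTransfer L (proj₂ abstractValid) i isProg))
  where
  open Lifting sim envCommutes
  σ₀ : α
  σ₀ = proj₁ (pre _ preOK)
  L : Lift p σ₀ c'
  L = liftComputation c' envOK xpq (proj₂ (proj₂ (pre _ preOK)))
  abstractValid : OutCond ρ (Lift.computation L) Q × ProgCond ρ (Lift.computation L) G
  abstractValid = pValid (Lift.computation L) (liftedEnvCond L) (proj₁ (proj₂ (pre _ preOK)))
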